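{- Let $M$ be a matroid on a finite set $E$ and $\lambda\in\mathbb{N}^E$. For each $e\in E$ let $E_e$ be a set with $\lambda(e)$ elements such that $e\in E_e$ and $E_e\cap E_f=\emptyset$ for $e\neq f$, and let $E(M_\lambda)=\bigsqcup_{e\in E}E_e$. Let $\mathcal{B}(M_\lambda)$ be the collection of all subsets $B\subseteq E(M_\lambda)$ for which there exist a basis $B'$ of $M$ and a tuple $(x_e)_{e\notin B'}\in\prod_{e\notin B'}E_e$ with $B=E(M_\lambda)\setminus\{x_e:e\notin B'\}$. Then $\mathcal{B}(M_\lambda)$ is the set of bases of a matroid on $E(M_\lambda)$.
   Context: $\mathbb{N}$ denotes the positive integers; $\mathbb{N}^E$ is the set of maps $E\to\mathbb{N}$. -}

module Defs where

open import Data.Nat using (ℕ)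
open import Data.Bool using (Bool; true; false; if_then_else_)
open import Data.Fin using (Fin)
import Data.Fin.Properties as FinP
open import Data.Product using (Σ; ∃; _×_; _,_)
open import Data.Product.Properties using (≡-dec)
open import Relation.Binary.Definitions using (DecidableEquality)
open import Relation.Binary.PropositionalEquality using (_≡_)
open import Relation.Nullary.Decidable using (⌊_⌋)
open import Function.Bundles using (_⇔_)

SubsetOf : Set → Set
SubsetOf X = X → Bool

swapOut : {X : Set} → DecidableEquality X → SubsetOf X → X → X → SubsetOf X
swapOut _≟_ A x y z = if ⌊ z ≟ x ⌋ then false else (if ⌊ z ≟ y ⌋ then true else A z)

-- 𝓑 is the set of bases of a matroid on X (basis axioms), where 𝓑 is a
-- family of subsets, required to be closed under extensional equality
-- of subsets (so that it really is a set of subsets).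
record IsMatroidBases {X : Set} (_≟_ : DecidableEquality X)
                      (𝓑 : SubsetOf X → Set) : Set₁ where
  field
    ext      : ∀ A B → (∀ z → A z ≡ B z) → 𝓑 A → 𝓑 B
    nonempty : ∃ λ B → 𝓑 B
    exchange : ∀ A B → 𝓑 A → 𝓑 B → ∀ x → A x ≡ true → B x ≡ false →
               ∃ λ y → B y ≡ true × A y ≡ false × 𝓑 (swapOut _≟_ A x y)

-- Ground set of M_λ : E(M_λ) = ⨆_{e} E_e with E_e = {e} × Fin (λ e);
-- the element e of E is identified with (e , zero).
Parallel : (n : ℕ) → (Fin n → ℕ) → Set
Parallel n lam = Σ (Fin n) (λ e → Fin (lam e))

Parallel-≟ : (n : ℕ) (lam : Fin n → ℕ) → DecidableEquality (Parallel n lam)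
Parallel-≟ n lam = ≡-dec FinP._≟_ FinP._≟_

ParallelBases : (n : ℕ) (lam : Fin n → ℕ) → (SubsetOf (Fin n) → Set) →
                SubsetOf (Parallel n lam) → Set
ParallelBases n lam 𝓑M B =
  Σ (SubsetOf (Fin n)) λ B' → 𝓑M B' ×
  Σ ((e : Fin n) → B' e ≡ false → Fin (lam e)) λ x →
    ∀ e i → (B (e , i) ≡ false ⇔ Σ (B' e ≡ false) (λ p → x e p ≡ i))

-- A basis of M_λ is encoded by a basis a of M together with a total choice
-- t e ∈ E_e (ignored for e ∈ a): it is the set `deleting a t` of all (e , k)
-- except the chosen ones (e , t e) with e ∉ a.  For the exchange axiom take
-- x = (e , i) ∈ A ∖ B, A = deleting a s, B = deleting b t; then e ∉ b and
-- t e = i.  If e ∉ a, the element (e , s e) of B ∖ A can replace x, which just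
-- moves the choice in E_e from s e to i.  If e ∈ a, exchange e in M for some
-- f ∈ b ∖ a, and replace x by (f , s f), again choosing i in E_e.
module Submission where

open import Defs
open import Data.Nat using (ℕ; _≤_)
open import Data.Fin using (Fin; fromℕ<)
open import Data.Fin.Properties using (_≟_)
open import Data.Bool using (Bool; true; false; not; _∨_)
open import Data.Bool.Properties using (∨-zeroʳ)
open import Data.Product using (∃; _×_; _,_; proj₁; proj₂)
open import Function using (_∘_)
open import Function.Bundles using (_⇔_; mk⇔; Equivalence)
open import Relation.Nullary using (Dec; yes; no; ¬_; contradiction)
open import Relation.Nullary.Decidable using (⌊_⌋; isYes≗does; dec-true; dec-false)
open import Relation.Binary.Definitions using (DecidableEquality)
open import Relation.Binary.PropositionalEquality
  using (_≡_; _≢_; _≗_; refl; sym; trans; cong)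

⌊⌋-yes : ∀ {A : Set} (a? : Dec A) → A → ⌊ a? ⌋ ≡ true
⌊⌋-yes a? a = trans (isYes≗does a?) (dec-true a? a)

⌊⌋-no : ∀ {A : Set} (a? : Dec A) → ¬ A → ⌊ a? ⌋ ≡ false
⌊⌋-no a? ¬a = trans (isYes≗does a?) (dec-false a? ¬a)

≡false⇔≡false⇒≡ : ∀ {u v : Bool} → u ≡ false ⇔ v ≡ false → u ≡ v
≡false⇔≡false⇒≡ {true}  {true}  _ = refl
≡false⇔≡false⇒≡ {true}  {false} h = Equivalence.from h refl
≡false⇔≡false⇒≡ {false} {true}  h = sym (Equivalence.to h refl)
≡false⇔≡false⇒≡ {false} {false} _ = refl

totalise : ∀ {A : Set} (b : Bool) → (b ≡ false → A) → A → A
totalise true  _ d = d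
totalise false f _ = f refl

totalise-≡ : ∀ {A : Set} b (f : b ≡ false → A) d (p : b ≡ false) → totalise b f d ≡ f p
totalise-≡ false f d refl = refl

module _ {X : Set} (_≟X_ : DecidableEquality X) where

  swapOut-out : ∀ A x y → swapOut _≟X_ A x y x ≡ false
  swapOut-out A x y rewrite ⌊⌋-yes (x ≟X x) refl = refl

  swapOut-in : ∀ A {x y} → y ≢ x → swapOut _≟X_ A x y y ≡ true
  swapOut-in A {x} {y} y≢x rewrite ⌊⌋-no (y ≟X x) y≢x | ⌊⌋-yes (y ≟X y) refl = refl

  swapOut-other : ∀ A {x y z} → z ≢ x → z ≢ y → swapOut _≟X_ A x y z ≡ A z
  swapOut-other A {x} {y} {z} z≢x z≢y rewrite ⌊⌋-no (z ≟X x) z≢x | ⌊⌋-no (z ≟X y) z≢y = refl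

  swapOut-cong : ∀ {A A′} → A ≗ A′ → ∀ x y → swapOut _≟X_ A x y ≗ swapOut _≟X_ A′ x y
  swapOut-cong A≗A′ x y z rewrite A≗A′ z = refl

module _ (n : ℕ) (lam : Fin n → ℕ) where

  private
    _≟∥_ = Parallel-≟ n lam

  Choice : Set
  Choice = (e : Fin n) → Fin (lam e)

  _[_≔_] : Choice → (e : Fin n) → Fin (lam e) → Choice
  (t [ e ≔ i ]) g with g ≟ e
  ... | yes refl = i
  ... | no  _    = t g

  [≔]-same : ∀ t e i → (t [ e ≔ i ]) e ≡ i
  [≔]-same t e i with e ≟ e
  ... | yes refl = refl
  ... | no  e≢e  = contradiction refl e≢e

  [≔]-same-≢ : ∀ t e {i k} → k ≢ i → (t [ e ≔ i ]) e ≢ k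
  [≔]-same-≢ t e {i} k≢i t≡k = k≢i (trans (sym t≡k) ([≔]-same t e i))

  [≔]-other : ∀ t {e} i {g} → g ≢ e → (t [ e ≔ i ]) g ≡ t g
  [≔]-other t {e} i {g} g≢e with g ≟ e
  ... | yes g≡e = contradiction g≡e g≢e
  ... | no  _   = refl

  deleting : SubsetOf (Fin n) → Choice → SubsetOf (Parallel n lam)
  deleting a t (e , k) = a e ∨ not ⌊ t e ≟ k ⌋

  deleting-false : ∀ a t e k → deleting a t (e , k) ≡ false ⇔ (a e ≡ false × t e ≡ k)
  deleting-false a t e k with a e | t e ≟ k
  ... | true  | _       = mk⇔ (λ ()) (λ { (() , _) })
  ... | false | yes t≡k = mk⇔ (λ _ → refl , t≡k) (λ _ → refl)
  ... | false | no  t≢k = mk⇔ (λ ()) (λ (_ , t≡k) → contradiction t≡k t≢k)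

  deleting-member : ∀ a t {e} k → a e ≡ true → deleting a t (e , k) ≡ true
  deleting-member a t k ae = cong (_∨ _) ae

  deleting-unchosen : ∀ a t {e k} → t e ≢ k → deleting a t (e , k) ≡ true
  deleting-unchosen a t {e} {k} t≢k rewrite ⌊⌋-no (t e ≟ k) t≢k = ∨-zeroʳ (a e)

  deleting-rechoose : ∀ {a} t {e} i → a e ≡ false →
    deleting a (t [ e ≔ i ]) ≗ swapOut _≟∥_ (deleting a t) (e , i) (e , t e)
  deleting-rechoose {a} t {e} i ae (g , k) with (g , k) ≟∥ (e , i) | (g , k) ≟∥ (e , t e)
  ... | yes refl | _ rewrite ae | [≔]-same t e i | ⌊⌋-yes (i ≟ i) refl = refl
  ... | no ≢ei | yes refl
    rewrite ae | [≔]-same t e i | ⌊⌋-no (i ≟ t e) (≢ei ∘ cong (e ,_) ∘ sym) = refl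
  ... | no ≢ei | no ≢et = unaffected (g ≟ e)
    where
    unaffected : Dec (g ≡ e) → deleting a (t [ e ≔ i ]) (g , k) ≡ deleting a t (g , k)
    unaffected (no g≢e) rewrite [≔]-other t i g≢e = refl
    unaffected (yes refl) =
      trans (deleting-unchosen a (t [ e ≔ i ]) ([≔]-same-≢ t e (≢ei ∘ cong (e ,_))))
            (sym (deleting-unchosen a t (≢et ∘ cong (e ,_) ∘ sym)))

  deleting-exchange : ∀ {a} t {e f} i → a e ≡ true → a f ≡ false →
    deleting (swapOut _≟_ a e f) (t [ e ≔ i ]) ≗ swapOut _≟∥_ (deleting a t) (e , i) (f , t f)
  deleting-exchange {a} t {e} {f} i ae af (g , k) with (g , k) ≟∥ (e , i) | (g , k) ≟∥ (f , t f)
  ... | yes refl | _ rewrite swapOut-out _≟_ a e f | [≔]-same t e i | ⌊⌋-yes (i ≟ i) refl = refl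
  ... | no _ | yes refl =
    deleting-member (swapOut _≟_ a e f) (t [ e ≔ i ]) (t f) (swapOut-in _≟_ a f≢e)
    where
    f≢e : f ≢ e
    f≢e refl with trans (sym ae) af
    ... | ()
  ... | no ≢ei | no ≢ft = unaffected (g ≟ e) (g ≟ f)
    where
    unaffected : Dec (g ≡ e) → Dec (g ≡ f) →
      deleting (swapOut _≟_ a e f) (t [ e ≔ i ]) (g , k) ≡ deleting a t (g , k)
    unaffected (yes refl) _ =
      trans (deleting-unchosen (swapOut _≟_ a e f) (t [ e ≔ i ]) ([≔]-same-≢ t e (≢ei ∘ cong (e ,_))))
            (sym (deleting-member a t k ae))
    unaffected (no g≢e) (yes refl) =
      trans (deleting-member (swapOut _≟_ a e f) (t [ e ≔ i ]) k (swapOut-in _≟_ a g≢e))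
            (sym (deleting-unchosen a t (≢ft ∘ cong (g ,_) ∘ sym)))
    unaffected (no g≢e) (no g≢f) rewrite swapOut-other _≟_ a g≢e g≢f | [≔]-other t i g≢e = refl

  module _ (𝓑M : SubsetOf (Fin n) → Set) where

    private
      𝓑 = ParallelBases n lam 𝓑M

    parallelBases-resp-≗ : ∀ A B → A ≗ B → 𝓑 A → 𝓑 B
    parallelBases-resp-≗ A B A≗B (a , ba , x , h) = a , ba , x , λ e i →
      mk⇔ (Equivalence.to (h e i) ∘ trans (A≗B (e , i)))
          (trans (sym (A≗B (e , i))) ∘ Equivalence.from (h e i))

    deleting-parallelBasis : ∀ {a} t → 𝓑M a → 𝓑 (deleting a t)
    deleting-parallelBasis {a} t ba = a , ba , (λ e _ → t e) , deleting-false a t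

    parallelBasis⇒deleting : Choice → ∀ {B} → 𝓑 B → ∃ λ a → ∃ λ t → 𝓑M a × B ≗ deleting a t
    parallelBasis⇒deleting default (a , ba , x , h) = a , t , ba , λ (e , k) →
      ≡false⇔≡false⇒≡ (mk⇔
        (λ Bz → let (p , xp≡k) = Equivalence.to (h e k) Bz in
           Equivalence.from (deleting-false a t e k) (p , trans (totalise-≡ _ (x e) _ p) xp≡k))
        (λ Dz → let (p , te≡k) = Equivalence.to (deleting-false a t e k) Dz in
           Equivalence.from (h e k) (p , trans (sym (totalise-≡ _ (x e) _ p)) te≡k)))
      where
      t : Choice
      t e = totalise (a e) (x e) (default e)

    module _ (M : IsMatroidBases _≟_ 𝓑M) where

      deleting-basisExchange : ∀ {a b} s t → 𝓑M a → 𝓑M b → ∀ e i →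
        deleting a s (e , i) ≡ true → deleting b t (e , i) ≡ false →
        ∃ λ y → deleting b t y ≡ true × deleting a s y ≡ false ×
                𝓑 (swapOut _≟∥_ (deleting a s) (e , i) y)
      deleting-basisExchange {a} {b} s t ba bb e i Ax Bx = split (a e) refl
        where
        be : b e ≡ false
        be = proj₁ (Equivalence.to (deleting-false b t e i) Bx)

        t≡i : t e ≡ i
        t≡i = proj₂ (Equivalence.to (deleting-false b t e i) Bx)

        split : ∀ c → a e ≡ c →
          ∃ λ y → deleting b t y ≡ true × deleting a s y ≡ false ×
                  𝓑 (swapOut _≟∥_ (deleting a s) (e , i) y)
        split false ae =
          (e , s e) , deleting-unchosen b t (λ t≡s → s≢i (trans (sym t≡s) t≡i)) ,
          Equivalence.from (deleting-false a s e (s e)) (ae , refl) ,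
          parallelBases-resp-≗ _ _ (deleting-rechoose s i ae) (deleting-parallelBasis _ ba)
          where
          s≢i : s e ≢ i
          s≢i s≡i with trans (sym Ax) (Equivalence.from (deleting-false a s e i) (ae , s≡i))
          ... | ()
        split true ae with IsMatroidBases.exchange M a b ba bb e ae be
        ... | f , bf , af , bab = (f , s f) , deleting-member b t (s f) bf ,
          Equivalence.from (deleting-false a s f (s f)) (af , refl) ,
          parallelBases-resp-≗ _ _ (deleting-exchange s i ae af) (deleting-parallelBasis _ bab)

      parallelBases-exchange : Choice → ∀ A B → 𝓑 A → 𝓑 B → ∀ x → A x ≡ true → B x ≡ false →
        ∃ λ y → B y ≡ true × A y ≡ false × 𝓑 (swapOut _≟∥_ A x y)
      parallelBases-exchange default A B 𝓑A 𝓑B (e , i) Ax Bx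
        with parallelBasis⇒deleting default 𝓑A | parallelBasis⇒deleting default 𝓑B
      ... | a , s , ba , A≗ | b , t , bb , B≗
        with deleting-basisExchange s t ba bb e i (trans (sym (A≗ _)) Ax) (trans (sym (B≗ _)) Bx)
      ... | y , By , Ay , 𝓑A′ = y , trans (B≗ y) By , trans (A≗ y) Ay ,
        parallelBases-resp-≗ _ _ (swapOut-cong _≟∥_ (sym ∘ A≗) (e , i) y) 𝓑A′

      parallelBases-isMatroidBases : Choice → IsMatroidBases _≟∥_ 𝓑
      parallelBases-isMatroidBases default = record
        { ext      = parallelBases-resp-≗
        ; nonempty = let (a , ba) = IsMatroidBases.nonempty M in
                     deleting a default , deleting-parallelBasis default ba
        ; exchange = parallelBases-exchange default
        }

proposition3p3 : (n : ℕ) (𝓑M : SubsetOf (Fin n) → Set) →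
    IsMatroidBases _≟_ 𝓑M →
    (lam : Fin n → ℕ) → (∀ e → 1 ≤ lam e) →
    IsMatroidBases (Parallel-≟ n lam) (ParallelBases n lam 𝓑M)
proposition3p3 n 𝓑M M lam pos =
  parallelBases-isMatroidBases n lam 𝓑M M (λ e → fromℕ< (pos e))
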